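{- For every $n\ge 1$, Snort played on the (initially uncoloured, untinted) graph $G_n$ is a first player win, where $G_n$ is obtained from $T_{n,3}$ by adding two new vertices $L_1, R_3$ and the edges $L_1\sim(1,1)$, $L_1\sim(1,2)$, $(n,2)\sim R_3$, $(n,3)\sim R_3$.
   Context: Snort is a two-player game (players Left and Right) played on a finite simple graph. The players alternately colour a previously uncoloured vertex, Left in blue and Right in red, subject to the rule that no two adjacent vertices may receive opposite colours. Normal play: a player who cannot move on their turn loses. A game is a "first player win" if the player who moves first has a winning strategy, regardless of whether that player is Left or Right. $T_{n,3}$ is the graph with vertex set $\{(i,j): 1\le i\le n,\ 1\le j\le 3\}$ and edges $(i,j)\sim(i+1,j)$ for $1\le i\le n-1$, $1\le j\le 3$; $(i,j)\sim(i,j+1)$ for $1\le i\le n$, $1\le j\le 2$; and $(i,j)\sim(i+1,j+1)$ for $1\le i\le n-1$, $1\le j\le 2$. -}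

module Defs where

open import Data.Nat using (ℕ; suc; _≥_)
open import Data.Fin using (Fin; toℕ)
import Data.Fin as Fin
open import Data.Maybe using (Maybe; just; nothing)
open import Data.Sum using (_⊎_)
open import Data.Product using (_×_)
open import Relation.Binary.Definitions using (DecidableEquality)
open import Relation.Binary.PropositionalEquality using (_≡_; _≢_; refl; cong₂)
open import Relation.Nullary using (¬_; yes; no)
open import Data.Empty using (⊥)

data Player : Set where
  Left Right : Player

opp : Player → Player
opp Left  = Right
opp Right = Left

-- A position: each vertex is uncoloured (nothing) or coloured by the
-- player who coloured it (Left = blue, Right = red).
Position : Set → Set
Position V = V → Maybe Player

module Snort {V : Set} (_≟_ : DecidableEquality V) (Adj : V → V → Set) where

  Legal : Player → Position V → V → Set
  Legal p c v = (c v ≡ nothing) × (∀ w → Adj v w → c w ≢ just (opp p))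

  play : Position V → V → Player → Position V
  play c v p w with w ≟ v
  ... | yes _ = just p
  ... | no  _ = c w

  data Wins  : Player → Position V → Set
  data Loses : Player → Position V → Set

  data Wins where
    move : ∀ {p c} (v : V) → Legal p c v → Loses (opp p) (play c v p) → Wins p c

  data Loses where
    stuck : ∀ {p c} → (∀ v → Legal p c v → Wins (opp p) (play c v p)) → Loses p c

  empty : Position V
  empty _ = nothing

  FirstPlayerWin : Set
  FirstPlayerWin = Wins Left empty × Wins Right empty

-- The graph G_n.  Cell (i , j) of T_{n,3} (1 ≤ i ≤ n, 1 ≤ j ≤ 3) is
-- represented as  cell i' j'  with toℕ i' = i - 1, toℕ j' = j - 1.

data GV (n : ℕ) : Set where
  cell : Fin n → Fin 3 → GV n
  L₁   : GV n
  R₃   : GV n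

_≟G_ : ∀ {n} → DecidableEquality (GV n)
cell i j ≟G cell i' j' with i Fin.≟ i' | j Fin.≟ j'
... | yes refl | yes refl = yes refl
... | no ne | _ = no λ { refl → ne refl }
... | yes _ | no ne = no λ { refl → ne refl }
cell _ _ ≟G L₁ = no λ ()
cell _ _ ≟G R₃ = no λ ()
L₁ ≟G cell _ _ = no λ ()
L₁ ≟G L₁ = yes refl
L₁ ≟G R₃ = no λ ()
R₃ ≟G cell _ _ = no λ ()
R₃ ≟G L₁ = no λ ()
R₃ ≟G R₃ = yes refl

-- the edges of G_n, each listed in one direction
data Edge (n : ℕ) : GV n → GV n → Set where
  vert  : ∀ {i i' j} → toℕ i' ≡ suc (toℕ i) → Edge n (cell i j) (cell i' j)
  horiz : ∀ {i j j'} → toℕ j' ≡ suc (toℕ j) → Edge n (cell i j) (cell i j')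
  diag  : ∀ {i i' j j'} → toℕ i' ≡ suc (toℕ i) → toℕ j' ≡ suc (toℕ j) →
          Edge n (cell i j) (cell i' j')
  L₁-1  : ∀ {i j} → toℕ i ≡ 0 → toℕ j ≡ 0 → Edge n L₁ (cell i j)
  L₁-2  : ∀ {i j} → toℕ i ≡ 0 → toℕ j ≡ 1 → Edge n L₁ (cell i j)
  R₃-2  : ∀ {i j} → suc (toℕ i) ≡ n → toℕ j ≡ 1 → Edge n (cell i j) R₃
  R₃-3  : ∀ {i j} → suc (toℕ i) ≡ n → toℕ j ≡ 2 → Edge n (cell i j) R₃

AdjG : (n : ℕ) → GV n → GV n → Set
AdjG n u v = Edge n u v ⊎ Edge n v u

module SnortG (n : ℕ) = Snort (_≟G_ {n}) (AdjG n)

-- The half-turn ρ of G_n, (i , j) ↦ (n + 1 − i , 4 − j) with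
-- L₁ ↔ R₃, is an automorphism, and apart from a middle cell c of column 2 and ρ c
-- (equal for odd n, vertically adjacent for even n) no vertex equals or touches its
-- image.  The first player colours c and then answers every move v by colouring ρ v.
-- The answer is legal: a neighbour w of ρ v in the opponent's colour would make ρ w,
-- in the first player's colour, a neighbour of v.  Hence the first player always has
-- a move, and the game is finite.
module Submission where

open import Defs
open import Data.Nat using (ℕ; _≥_)

open import Data.Nat using (zero; suc; _+_; _≤_; _<_; ⌊_/2⌋; ⌈_/2⌉; z≤n; s≤s; s≤s⁻¹)
open import Data.Nat.Properties
  using ( ≤-refl; ≤-trans; ≤-antisym; ≤-<-trans; n≤1+n; <-cmp; <-irrefl
        ; m≤n⇒m<n∨m≡n; +-mono-≤; +-mono-<-≤; +-mono-≤-<; +-cancelˡ-≡; +-suc; +-identityʳ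
        ; suc-injective; m+[n∸m]≡n; ⌊n/2⌋≤n; ⌊n/2⌋-mono; ⌊n/2⌋≤⌈n/2⌉; ⌊n/2⌋+⌈n/2⌉≡n )
open import Data.Nat.Induction using (<-wellFounded)
open import Induction.WellFounded using (Acc; acc)
open import Data.Fin using (Fin; toℕ; fromℕ<; opposite)
open import Data.Fin.Properties
  using (toℕ-injective; toℕ-fromℕ<; toℕ≤pred[n]; opposite-prop; opposite-involutive)
open import Data.Maybe using (Maybe; just; nothing; map)
open import Data.Maybe.Properties using (just-injective)
open import Data.Product using (_×_; _,_; proj₁; proj₂)
open import Data.Sum using (_⊎_; inj₁; inj₂; swap)
open import Data.List using (List; []; _∷_; allFin; cartesianProductWith)
open import Data.List.Membership.Propositional using (_∈_)
open import Data.List.Membership.Propositional.Properties using (∈-allFin; ∈-cartesianProductWith⁺)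
open import Data.List.Relation.Unary.Any using (here; there)
open import Data.Empty using (⊥-elim)
open import Function using (_∘_)
open import Relation.Binary.Definitions using (DecidableEquality; Symmetric; tri<; tri≈; tri>)
open import Relation.Binary.PropositionalEquality
  using (_≡_; _≢_; refl; sym; trans; cong; cong₂; subst; subst₂; module ≡-Reasoning)
open import Relation.Nullary using (¬_; yes; no; Dec)
open import Relation.Nullary.Decidable using (_⊎-dec_)

opp-involutive : ∀ p → opp (opp p) ≡ p
opp-involutive Left  = refl
opp-involutive Right = refl

opp-≢ : ∀ p → opp p ≢ p
opp-≢ Left  ()
opp-≢ Right ()

module SnortProperties {V : Set} (_≟_ : DecidableEquality V) (Adj : V → V → Set) where
  open Snort _≟_ Adj

  play-≡ : ∀ c v p → play c v p v ≡ just p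
  play-≡ c v p with v ≟ v
  ... | yes _   = refl
  ... | no  v≢v = ⊥-elim (v≢v refl)

  play-≢ : ∀ c {v} p {w} → w ≢ v → play c v p w ≡ c w
  play-≢ c {v} p {w} w≢v with w ≟ v
  ... | yes w≡v = ⊥-elim (w≢v w≡v)
  ... | no  _   = refl

  blank : Maybe Player → ℕ
  blank nothing  = 1
  blank (just _) = 0

  uncoloured : Position V → List V → ℕ
  uncoloured c []       = 0
  uncoloured c (x ∷ xs) = blank (c x) + uncoloured c xs

  blank-play-≤ : ∀ c v p x → blank (play c v p x) ≤ blank (c x)
  blank-play-≤ c v p x with x ≟ v
  ... | yes _ = z≤n
  ... | no  _ = ≤-refl

  uncoloured-play-≤ : ∀ c v p xs → uncoloured (play c v p) xs ≤ uncoloured c xs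
  uncoloured-play-≤ c v p []       = z≤n
  uncoloured-play-≤ c v p (x ∷ xs) = +-mono-≤ (blank-play-≤ c v p x) (uncoloured-play-≤ c v p xs)

  uncoloured-play-< : ∀ {c v} p {xs} → c v ≡ nothing → v ∈ xs →
                      uncoloured (play c v p) xs < uncoloured c xs
  uncoloured-play-< {c} {v} p {_ ∷ xs} cv≡nothing (here refl)
    rewrite play-≡ c v p | cv≡nothing = s≤s (uncoloured-play-≤ c v p xs)
  uncoloured-play-< {c} {v} p {x ∷ _} cv≡nothing (there v∈xs) =
    +-mono-≤-< (blank-play-≤ c v p x) (uncoloured-play-< p cv≡nothing v∈xs)

  record CentralSymmetry : Set where
    field
      σ                     : V → V
      σ-involutive          : ∀ v → σ (σ v) ≡ v
      σ-adj                 : ∀ {u v} → Adj u v → Adj (σ u) (σ v)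
      centre                : V
      centre-touches-image  : centre ≡ σ centre ⊎ Adj centre (σ centre)
      touches-image⇒central : ∀ {v} → v ≡ σ v ⊎ Adj v (σ v) → v ≡ centre ⊎ v ≡ σ centre

  module MirrorStrategy (adj-sym : Symmetric Adj)
                        (vertices : List V) (∈-vertices : ∀ v → v ∈ vertices)
                        (S : CentralSymmetry) (p : Player) where
    open CentralSymmetry S

    σ-injective : ∀ {u v} → σ u ≡ σ v → u ≡ v
    σ-injective {u} {v} σu≡σv = trans (sym (σ-involutive u)) (trans (cong σ σu≡σv) (σ-involutive v))

    σ-transpose : ∀ {u v} → σ u ≡ v → u ≡ σ v
    σ-transpose {u} σu≡v = trans (sym (σ-involutive u)) (cong σ σu≡v)

    Central : V → Set
    Central v = v ≡ centre ⊎ v ≡ σ centre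

    central? : ∀ v → Dec (Central v)
    central? v = (v ≟ centre) ⊎-dec (v ≟ σ centre)

    ¬central-σ : ∀ {v} → ¬ Central v → ¬ Central (σ v)
    ¬central-σ ¬central (inj₁ σv≡centre) = ¬central (inj₂ (σ-transpose σv≡centre))
    ¬central-σ ¬central (inj₂ σv≡σcentre) = ¬central (inj₁ (σ-injective σv≡σcentre))

    ¬central⇒≢σ : ∀ {v} → ¬ Central v → v ≢ σ v
    ¬central⇒≢σ ¬central = ¬central ∘ touches-image⇒central ∘ inj₁

    ¬central⇒¬adj-σ : ∀ {v} → ¬ Central v → ¬ Adj v (σ v)
    ¬central⇒¬adj-σ ¬central = ¬central ∘ touches-image⇒central ∘ inj₂

    central-≢ : ∀ {v w} → ¬ Central v → Central w → w ≢ v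
    central-≢ ¬central central w≡v = ¬central (subst Central w≡v central)

    -- When σ centre ≠ centre it stays uncoloured: the opponent may not colour it next to
    -- centre, and the first player only colours images of non-central vertices.
    record Mirrored (c : Position V) : Set where
      field
        centre-owned      : c centre ≡ just p
        image-not-opposed : c (σ centre) ≢ just (opp p)
        mirror            : ∀ x → ¬ Central x → c (σ x) ≡ map opp (c x)
    open Mirrored

    reply : Position V → V → Position V
    reply c v = play (play c v (opp p)) (σ v) p

    module _ {c : Position V} (m : Mirrored c) {v : V} (legal : Legal (opp p) c v) where

      opponent-≢-centre : v ≢ centre
      opponent-≢-centre refl with trans (sym (proj₁ legal)) (centre-owned m)
      ... | ()

      opponent-off-centre : ¬ Central v
      opponent-off-centre (inj₁ v≡centre) = opponent-≢-centre v≡centre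
      opponent-off-centre (inj₂ refl) with centre-touches-image
      ... | inj₁ centre≡σcentre = opponent-≢-centre (sym centre≡σcentre)
      ... | inj₂ adj = proj₂ legal centre (adj-sym adj)
                         (trans (centre-owned m) (cong just (sym (opp-involutive p))))

      image-neighbour-not-opposed : ∀ w → Adj (σ v) w → c w ≢ just (opp p)
      image-neighbour-not-opposed w adj cw≡opp with central? w
      ... | yes (inj₁ refl) = opp-≢ p (just-injective (trans (sym cw≡opp) (centre-owned m)))
      ... | yes (inj₂ refl) = image-not-opposed m cw≡opp
      ... | no ¬central = proj₂ legal (σ w)
                            (subst (λ u → Adj u (σ w)) (σ-involutive v) (σ-adj adj))
                            (trans (mirror m w ¬central) (cong (map opp) cw≡opp))

      reply-legal : Legal p (play c v (opp p)) (σ v)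
      reply-legal = image-free , image-safe
        where
        image-free : play c v (opp p) (σ v) ≡ nothing
        image-free = trans (play-≢ c (opp p) (¬central⇒≢σ opponent-off-centre ∘ sym))
                           (trans (mirror m v opponent-off-centre) (cong (map opp) (proj₁ legal)))
        image-safe : ∀ w → Adj (σ v) w → play c v (opp p) w ≢ just (opp p)
        image-safe w adj with w ≟ v
        ... | yes refl = ⊥-elim (¬central⇒¬adj-σ opponent-off-centre (adj-sym adj))
        ... | no  _    = image-neighbour-not-opposed w adj

      reply-untouched : ∀ {w} → Central w → reply c v w ≡ c w
      reply-untouched central =
        trans (play-≢ _ p (central-≢ (¬central-σ opponent-off-centre) central))
              (play-≢ c (opp p) (central-≢ opponent-off-centre central))

      reply-at-σv : reply c v (σ v) ≡ just p
      reply-at-σv = play-≡ _ (σ v) p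

      reply-at-v : reply c v v ≡ just (opp p)
      reply-at-v = trans (play-≢ _ p (¬central⇒≢σ opponent-off-centre)) (play-≡ c v (opp p))

      reply-mirror-cases : ∀ x → ¬ Central x → Dec (x ≡ v) → Dec (x ≡ σ v) →
                           reply c v (σ x) ≡ map opp (reply c v x)
      reply-mirror-cases x _ (yes refl) _ = begin
        reply c v (σ v)              ≡⟨ reply-at-σv ⟩
        just p                       ≡⟨ cong just (opp-involutive p) ⟨
        map opp (just (opp p))       ≡⟨ cong (map opp) reply-at-v ⟨
        map opp (reply c v v)        ∎
        where open ≡-Reasoning
      reply-mirror-cases x _ (no _) (yes refl) = begin
        reply c v (σ (σ v))          ≡⟨ cong (reply c v) (σ-involutive v) ⟩
        reply c v v                  ≡⟨ reply-at-v ⟩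
        map opp (just p)             ≡⟨ cong (map opp) reply-at-σv ⟨
        map opp (reply c v (σ v))    ∎
        where open ≡-Reasoning
      reply-mirror-cases x ¬central (no x≢v) (no x≢σv) = begin
        reply c v (σ x)              ≡⟨ play-≢ _ p (x≢v ∘ σ-injective) ⟩
        play c v (opp p) (σ x)       ≡⟨ play-≢ c (opp p) (x≢σv ∘ σ-transpose) ⟩
        c (σ x)                      ≡⟨ mirror m x ¬central ⟩
        map opp (c x)                ≡⟨ cong (map opp) (play-≢ c (opp p) x≢v) ⟨
        map opp (play c v (opp p) x) ≡⟨ cong (map opp) (play-≢ _ p x≢σv) ⟨
        map opp (reply c v x)        ∎
        where open ≡-Reasoning

      reply-mirror : ∀ x → ¬ Central x → reply c v (σ x) ≡ map opp (reply c v x)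
      reply-mirror x ¬central = reply-mirror-cases x ¬central (x ≟ v) (x ≟ σ v)

      reply-mirrored : Mirrored (reply c v)
      reply-mirrored = record
        { centre-owned      = trans (reply-untouched (inj₁ refl)) (centre-owned m)
        ; image-not-opposed = image-not-opposed m ∘ trans (sym (reply-untouched (inj₂ refl)))
        ; mirror            = reply-mirror
        }

      reply-decreases : uncoloured (reply c v) vertices < uncoloured c vertices
      reply-decreases = ≤-<-trans (uncoloured-play-≤ _ (σ v) p vertices)
                                  (uncoloured-play-< (opp p) (proj₁ legal) (∈-vertices v))

    mirror-loses : ∀ c → Acc _<_ (uncoloured c vertices) → Mirrored c → Loses (opp p) c
    mirror-loses c (acc smaller) m = stuck λ v legal →
      subst (λ r → Wins r (play c v (opp p))) (sym (opp-involutive p))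
        (move (σ v) (reply-legal m legal)
          (mirror-loses (reply c v) (smaller (reply-decreases m legal)) (reply-mirrored m legal)))

    opening-mirrored : Mirrored (play empty centre p)
    opening-mirrored = record
      { centre-owned      = play-≡ empty centre p
      ; image-not-opposed = image-not-opposed′
      ; mirror            = λ x ¬central →
          trans (play-≢ empty p (¬central-σ ¬central ∘ inj₁))
                (cong (map opp) (sym (play-≢ empty p (¬central ∘ inj₁))))
      }
      where
      image-not-opposed′ : play empty centre p (σ centre) ≢ just (opp p)
      image-not-opposed′ with σ centre ≟ centre
      ... | yes _ = λ p≡opp → opp-≢ p (sym (just-injective p≡opp))
      ... | no  _ = λ ()

    first-move-wins : Wins p empty
    first-move-wins =
      move centre (refl , λ _ _ ()) (mirror-loses _ (<-wellFounded _) opening-mirrored)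

  central-symmetry⇒first-player-win : Symmetric Adj → (vertices : List V) → (∀ v → v ∈ vertices) →
                                      CentralSymmetry → FirstPlayerWin
  central-symmetry⇒first-player-win adj-sym vertices ∈-vertices S =
    Strategy.first-move-wins Left , Strategy.first-move-wins Right
    where module Strategy = MirrorStrategy adj-sym vertices ∈-vertices S

Balanced : ℕ → ℕ → Set
Balanced a b = a ≤ b × b ≤ suc a

≡⇒balanced : ∀ {a b} → a ≡ b → Balanced a b
≡⇒balanced {a} refl = ≤-refl , n≤1+n a

suc⇒balanced : ∀ {a b} → b ≡ suc a → Balanced a b
suc⇒balanced {a} refl = n≤1+n a , ≤-refl

balanced-cases : ∀ {a b} → Balanced a b → b ≡ a ⊎ b ≡ suc a
balanced-cases (a≤b , b≤1+a) with m≤n⇒m<n∨m≡n b≤1+a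
... | inj₁ b<1+a = inj₁ (≤-antisym (s≤s⁻¹ b<1+a) a≤b)
... | inj₂ b≡1+a = inj₂ b≡1+a

balanced-< : ∀ {a b c d} → Balanced a b → Balanced c d → a < c → a + b < c + d
balanced-< (_ , b≤1+a) (c≤d , _) a<c = +-mono-<-≤ a<c (≤-trans b≤1+a (≤-trans a<c c≤d))

balanced-unique : ∀ {a b c d} → a + b ≡ c + d → Balanced a b → Balanced c d → a ≡ c
balanced-unique {a} {c = c} a+b≡c+d ab cd with <-cmp a c
... | tri< a<c _ _ = ⊥-elim (<-irrefl a+b≡c+d (balanced-< ab cd a<c))
... | tri≈ _ a≡c _ = a≡c
... | tri> _ _ c<a = ⊥-elim (<-irrefl (sym a+b≡c+d) (balanced-< cd ab c<a))

⌈n/2⌉≤1+⌊n/2⌋ : ∀ n → ⌈ n /2⌉ ≤ suc ⌊ n /2⌋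
⌈n/2⌉≤1+⌊n/2⌋ n = ⌊n/2⌋-mono (n≤1+n (suc n))

toℕ+toℕ-opposite : ∀ {N} (i : Fin (suc N)) → toℕ i + toℕ (opposite i) ≡ N
toℕ+toℕ-opposite i = trans (cong (toℕ i +_) (opposite-prop i)) (m+[n∸m]≡n (toℕ≤pred[n] i))

toℕ-opposite : ∀ {N a b} (i : Fin (suc N)) → a + b ≡ N → toℕ i ≡ a → toℕ (opposite i) ≡ b
toℕ-opposite i a+b≡N refl = +-cancelˡ-≡ (toℕ i) _ _ (trans (toℕ+toℕ-opposite i) (sym a+b≡N))

opposite-step : ∀ {N} {i i′ : Fin (suc N)} →
                toℕ i′ ≡ suc (toℕ i) → toℕ (opposite i) ≡ suc (toℕ (opposite i′))
opposite-step {N} {i} {i′} i′≡1+i = toℕ-opposite i sum refl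
  where
  open ≡-Reasoning
  sum : toℕ i + suc (toℕ (opposite i′)) ≡ N
  sum = begin
    toℕ i + suc (toℕ (opposite i′))  ≡⟨ +-suc (toℕ i) _ ⟩
    suc (toℕ i) + toℕ (opposite i′)  ≡⟨ cong (_+ toℕ (opposite i′)) (sym i′≡1+i) ⟩
    toℕ i′ + toℕ (opposite i′)       ≡⟨ toℕ+toℕ-opposite i′ ⟩
    N                                ∎

middle : ∀ N → Fin (suc N)
middle N = fromℕ< (s≤s (⌊n/2⌋≤n N))

middle-balanced : ∀ N → Balanced (toℕ (middle N)) (toℕ (opposite (middle N)))
middle-balanced N =
  subst₂ Balanced (sym (toℕ-fromℕ< _))
                  (sym (toℕ-opposite (middle N) (⌊n/2⌋+⌈n/2⌉≡n N) (toℕ-fromℕ< _)))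
                  (⌊n/2⌋≤⌈n/2⌉ N , ⌈n/2⌉≤1+⌊n/2⌋ N)

middle-unique : ∀ {N} (i : Fin (suc N)) → Balanced (toℕ i) (toℕ (opposite i)) → i ≡ middle N
middle-unique {N} i balanced = toℕ-injective
  (balanced-unique (trans (toℕ+toℕ-opposite i) (sym (toℕ+toℕ-opposite (middle N))))
                   balanced (middle-balanced N))

column-no-step : (j : Fin 3) → toℕ (opposite j) ≢ suc (toℕ j)
column-no-step Fin.zero ()
column-no-step (Fin.suc Fin.zero) ()
column-no-step (Fin.suc (Fin.suc Fin.zero)) ()

cell-injective : ∀ {n} {i i′ : Fin n} {j j′ : Fin 3} → cell i j ≡ cell i′ j′ → i ≡ i′ × j ≡ j′
cell-injective refl = refl , refl

module HalfTurn (N : ℕ) where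
  open SnortProperties (_≟G_ {suc N}) (AdjG (suc N))

  rotate : GV (suc N) → GV (suc N)
  rotate (cell i j) = cell (opposite i) (opposite j)
  rotate L₁         = R₃
  rotate R₃         = L₁

  rotate-involutive : ∀ v → rotate (rotate v) ≡ v
  rotate-involutive (cell i j) = cong₂ cell (opposite-involutive i) (opposite-involutive j)
  rotate-involutive L₁         = refl
  rotate-involutive R₃         = refl

  rotate-edge : ∀ {u v} → Edge (suc N) u v → Edge (suc N) (rotate v) (rotate u)
  rotate-edge (vert e)                 = vert (opposite-step e)
  rotate-edge (horiz e)                = horiz (opposite-step e)
  rotate-edge (diag e e′)              = diag (opposite-step e) (opposite-step e′)
  rotate-edge (L₁-1 {i} {j} i≡0 j≡0)   =
    R₃-3 (cong suc (toℕ-opposite i refl i≡0)) (toℕ-opposite j refl j≡0)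
  rotate-edge (L₁-2 {i} {j} i≡0 j≡1)   =
    R₃-2 (cong suc (toℕ-opposite i refl i≡0)) (toℕ-opposite j refl j≡1)
  rotate-edge (R₃-2 {i} {j} 1+i≡n j≡1) =
    L₁-2 (toℕ-opposite i (+-identityʳ N) (suc-injective 1+i≡n)) (toℕ-opposite j refl j≡1)
  rotate-edge (R₃-3 {i} {j} 1+i≡n j≡2) =
    L₁-1 (toℕ-opposite i (+-identityʳ N) (suc-injective 1+i≡n)) (toℕ-opposite j refl j≡2)

  rotate-adj : ∀ {u v} → AdjG (suc N) u v → AdjG (suc N) (rotate u) (rotate v)
  rotate-adj (inj₁ e) = inj₂ (rotate-edge e)
  rotate-adj (inj₂ e) = inj₁ (rotate-edge e)

  centre : GV (suc N)
  centre = cell (middle N) (middle 2)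

  centre-touches-image : centre ≡ rotate centre ⊎ AdjG (suc N) centre (rotate centre)
  centre-touches-image with balanced-cases (middle-balanced N)
  ... | inj₁ same = inj₁ (cong₂ cell (toℕ-injective (sym same)) refl)
  ... | inj₂ step = inj₂ (inj₁ (vert step))

  edge-to-image⇒centre : ∀ {u w} → Edge (suc N) u w → w ≡ rotate u → u ≡ centre
  edge-to-image⇒centre (vert {i} {j = j} e) w≡ρu with cell-injective w≡ρu
  ... | refl , j≡ρj = cong₂ cell (middle-unique i (suc⇒balanced e))
                                 (middle-unique j (≡⇒balanced (cong toℕ j≡ρj)))
  edge-to-image⇒centre (horiz {j = j} e) w≡ρu with cell-injective w≡ρu
  ... | _ , refl = ⊥-elim (column-no-step j e)
  edge-to-image⇒centre (diag {j = j} _ e) w≡ρu with cell-injective w≡ρu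
  ... | _ , refl = ⊥-elim (column-no-step j e)
  edge-to-image⇒centre (L₁-1 _ _) ()
  edge-to-image⇒centre (L₁-2 _ _) ()
  edge-to-image⇒centre (R₃-2 _ _) ()
  edge-to-image⇒centre (R₃-3 _ _) ()

  touches-image⇒central : ∀ {v} → v ≡ rotate v ⊎ AdjG (suc N) v (rotate v) →
                          v ≡ centre ⊎ v ≡ rotate centre
  touches-image⇒central {cell i j} (inj₁ fixed) with cell-injective fixed
  ... | i≡ρi , j≡ρj = inj₁ (cong₂ cell (middle-unique i (≡⇒balanced (cong toℕ i≡ρi)))
                                       (middle-unique j (≡⇒balanced (cong toℕ j≡ρj))))
  touches-image⇒central (inj₂ (inj₁ e)) = inj₁ (edge-to-image⇒centre e refl)
  touches-image⇒central {v} (inj₂ (inj₂ e)) = inj₂ (begin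
    v                   ≡⟨ rotate-involutive v ⟨
    rotate (rotate v)   ≡⟨ cong rotate (edge-to-image⇒centre e (sym (rotate-involutive v))) ⟩
    rotate centre       ∎)
    where open ≡-Reasoning

  half-turn : CentralSymmetry
  half-turn = record
    { σ                     = rotate
    ; σ-involutive          = rotate-involutive
    ; σ-adj                 = rotate-adj
    ; centre                = centre
    ; centre-touches-image  = centre-touches-image
    ; touches-image⇒central = touches-image⇒central
    }

  vertices : List (GV (suc N))
  vertices = L₁ ∷ R₃ ∷ cartesianProductWith cell (allFin (suc N)) (allFin 3)

  ∈-vertices : ∀ v → v ∈ vertices
  ∈-vertices L₁         = here refl
  ∈-vertices R₃         = there (here refl)
  ∈-vertices (cell i j) = there (there (∈-cartesianProductWith⁺ cell (∈-allFin i) (∈-allFin j)))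

  first-player-win : SnortG.FirstPlayerWin (suc N)
  first-player-win = central-symmetry⇒first-player-win swap vertices ∈-vertices half-turn

lemma3p3 : (n : ℕ) → n ≥ 1 → SnortG.FirstPlayerWin n
lemma3p3 zero    ()
lemma3p3 (suc N) _ = HalfTurn.first-player-win N
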